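{- Let $\Phi$ be a finite root system with Weyl group $W(\Phi)$ and longest element $w_0$. If $w\in W(\Phi)$ is separable, then $w_0w$ is also separable.
   Context: Let $\Phi$ have positive roots $\Phi^+$, simple roots $\Delta$; $I_\Phi(w)=\{\alpha\in\Phi^+:w\alpha\in-\Phi^+\}$. Root poset: $\beta\ge\alpha$ iff $\beta-\alpha$ is a nonnegative combination of simple roots. For $\Delta'\subseteq\Delta$, $\Phi'=\Phi\cap\mathrm{span}\,\Delta'$ with positive roots $\Phi^+\cap\Phi'$; $w|_{\Phi'}\in W(\Phi')$ has inversion set $I_\Phi(w)\cap\Phi'$. Separable (recursive): $w$ is separable if (a) $\Phi$ is of type $A_1$; or (b) $\Phi=\bigoplus_i\Phi_i$ is reducible and each $w|_{\Phi_i}$ is separable; or (c) $\Phi$ is irreducible and for some $\alpha_i\in\Delta$, $w|_{\Phi'}$ is separable for $\Phi'$ generated by $\Delta\setminus\{\alpha_i\}$, and either $\{\beta\in\Phi^+:\beta\ge\alpha_i\}\subseteq I_\Phi(w)$ or this set is disjoint from $I_\Phi(w)$. -}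

module Defs where

open import Data.Nat as ℕ using (ℕ; zero; suc)
open import Data.Fin using (Fin; zero; suc; _≟_)
open import Data.Fin.Subset as Sub using (Subset; _∈_; _∉_; _⊆_; _∪_; _∩_; ⁅_⁆; ⊤; Nonempty; Empty)
open import Data.Integer using (ℤ; +_; _+_; _-_; _*_; -_; _≤_; _<_)
open import Data.List using (List; []; _∷_)
open import Data.Product using (Σ; ∃; ∃-syntax; _×_; _,_)
open import Data.Sum using (_⊎_)
open import Relation.Nullary using (¬_; yes; no)
open import Relation.Binary.PropositionalEquality using (_≡_; _≢_)

Σℤ : ∀ n → (Fin n → ℤ) → ℤ
Σℤ zero    f = + 0
Σℤ (suc n) f = f zero + Σℤ n (λ i → f (suc i))

-- A finite (crystallographic, reduced) root system of rank n, given by its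
-- Cartan matrix with respect to the base Δ = {α₀,…,α_{n-1}}.
-- Convention: A i j = ⟨α_i^∨ , α_j⟩.  Finite type = symmetrizable with
-- positive definite symmetrization.

record CartanMatrix (n : ℕ) : Set where
  field
    A        : Fin n → Fin n → ℤ
    diag     : ∀ i → A i i ≡ + 2
    offdiag  : ∀ i j → i ≢ j → A i j ≤ + 0
    zero-sym : ∀ i j → A i j ≡ + 0 → A j i ≡ + 0
    d        : Fin n → ℕ
    d-pos    : ∀ i → 0 ℕ.< d i
    d-sym    : ∀ i j → (+ d i) * A i j ≡ (+ d j) * A j i
    posdef   : ∀ (x : Fin n → ℤ) → ¬ (∀ i → x i ≡ + 0) →
               + 0 < Σℤ n (λ i → Σℤ n (λ j → x i * ((+ d i) * A i j) * x j))

-- Vectors in the root lattice, in coordinates w.r.t. the simple roots.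
Vec : ℕ → Set
Vec n = Fin n → ℤ

module RootSystem {n : ℕ} (C : CartanMatrix n) where
  open CartanMatrix C

  e : Fin n → Vec n
  e i j with i ≟ j
  ... | yes _ = + 1
  ... | no  _ = + 0

  refl : Fin n → Vec n → Vec n
  refl i x j = x j - Σℤ n (λ k → A i k * x k) * e i j

  -- Weyl group elements as words in simple reflections;
  -- the word i₁ ∷ i₂ ∷ … ∷ i_k stands for s_{i₁} s_{i₂} ⋯ s_{i_k}
  Word : Set
  Word = List (Fin n)

  act : Word → Vec n → Vec n
  act []      x = x
  act (i ∷ w) x = refl i (act w x)

  IsRoot : Vec n → Set
  IsRoot β = Σ Word λ w → Σ (Fin n) λ i → ∀ k → β k ≡ act w (e i) k

  IsPosRoot : Vec n → Set
  IsPosRoot β = IsRoot β × (∀ k → + 0 ≤ β k)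

  neg : Vec n → Vec n
  neg x k = - x k

  _≥R_ : Vec n → Vec n → Set
  β ≥R γ = ∀ k → γ k ≤ β k

  Inv : Word → Vec n → Set
  Inv w β = IsPosRoot β × IsPosRoot (neg (act w β))

  IsLongest : Word → Set
  IsLongest w₀ = ∀ β → IsPosRoot β → Inv w₀ β

  -- Parabolic subsystems Φ' = Φ ∩ span Δ' for Δ' = {α_i : i ∈ S}

  InSpan : Subset n → Vec n → Set
  InSpan S β = ∀ k → k ∉ S → β k ≡ + 0

  IsPosRootIn : Subset n → Vec n → Set
  IsPosRootIn S β = IsPosRoot β × InSpan S β

  Reducible : Subset n → Set
  Reducible S = Σ (Subset n) λ S₁ → Σ (Subset n) λ S₂ →
    Nonempty S₁ × Nonempty S₂ × S₁ ∪ S₂ ≡ S × Empty (S₁ ∩ S₂) ×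
    (∀ i j → i ∈ S₁ → j ∈ S₂ → A i j ≡ + 0)

  Irreducible : Subset n → Set
  Irreducible S = Nonempty S × ¬ Reducible S

  Component : Subset n → Subset n → Set
  Component S C = C ⊆ S × Irreducible C ×
    (∀ i j → i ∈ C → j ∈ S → j ∉ C → A i j ≡ + 0)

  Up : Subset n → Fin n → Vec n → Set
  Up S i β = IsPosRootIn S β × β ≥R e i

  -- Sep w S : "w|_{Φ'} is separable", where Φ' is generated by {α_i : i ∈ S}.
  -- The inversion set of w|_{Φ'} is I_Φ(w) ∩ Φ'.
  data Sep (w : Word) : Subset n → Set where
    typeA₁    : ∀ i → Sep w ⁅ i ⁆
    reducible : ∀ S → Reducible S →
                (∀ C → Component S C → Sep w C) → Sep w S
    irreducible : ∀ S i → Irreducible S → i ∈ S → Sep w (S Sub.- i) →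
                ((∀ β → Up S i β → Inv w β) ⊎ (∀ β → Up S i β → ¬ Inv w β)) →
                Sep w S

  Separable : Word → Set
  Separable w = Sep w ⊤

module Submission where

-- The definition of separability only
-- asks, in clause (c), whether an upper set of positive roots lies inside or
-- outside the inversion set; since I(w₀w) = Φ⁺ ∖ I(w), a structural
-- induction on the separability derivation of w yields one for w₀w with the
-- two alternatives exchanged.
--
-- The complement identity rests on the dichotomy "every root is positive or
-- negative", which for Φ = W·Δ is the classical theorem ℓ(ws) ≥ ℓ(w) ⇒
-- w αₛ ≥ 0 (Humphreys §1.6–1.7): induct on ℓ(w), factor w = x·y with y in
-- ⟨sₛ, sₜ⟩ and x as short as possible, and finish in rank two, where positive
-- definiteness leaves six Cartan types whose braid relations and dihedral
-- roots are checked by evaluation.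

open import Defs
open import Data.Nat as N using (ℕ; zero; suc; z≤n; s≤s)
import Data.Nat.Properties as NP
open import Data.Integer as Z using (ℤ; +_; -[1+_]; +[1+_]; _+_; _-_; _*_; -_)
import Data.Integer.Properties as ZP
open import Data.Integer.Tactic.RingSolver using (solve-∀)
open import Data.Fin using (Fin; zero; suc; _≟_)
open import Data.Fin.Properties using (all?)
open import Data.List using (List; []; _∷_; _++_; _∷ʳ_; length; map; initLast; _∷ʳ′_)
open import Data.List.Properties using (length-++; map-++; ++-assoc; ++-identityʳ; length-map)
open import Data.Bool using (Bool; true; false; not)
import Data.Bool.Properties
open import Data.Product using (Σ; _×_; _,_; proj₁; proj₂)
open import Data.Sum using (_⊎_; inj₁; inj₂)
open import Data.Empty using (⊥; ⊥-elim)
open import Function using (_∘_)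
open import Relation.Nullary using (¬_; Dec; yes; no; _×-dec_)
open import Relation.Nullary.Decidable using (True; toWitness; decidable-stable; _⊎-dec_)
open import Relation.Binary.PropositionalEquality
open import Relation.Binary.Bundles using (Setoid)
import Relation.Binary.Reasoning.Setoid

Σℤ-cong : ∀ n {f g : Fin n → ℤ} → (∀ i → f i ≡ g i) → Σℤ n f ≡ Σℤ n g
Σℤ-cong zero    h = refl
Σℤ-cong (suc n) h = cong₂ _+_ (h zero) (Σℤ-cong n (λ i → h (suc i)))

Σℤ-+ : ∀ n (f g : Fin n → ℤ) → Σℤ n (λ i → f i + g i) ≡ Σℤ n f + Σℤ n g
Σℤ-+ zero    f g = refl
Σℤ-+ (suc n) f g =
  trans (cong (_+_ (f zero + g zero)) (Σℤ-+ n _ _)) (interchange (f zero) (g zero) _ _)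
  where
  interchange : ∀ a b c d → (a + b) + (c + d) ≡ (a + c) + (b + d)
  interchange = solve-∀

Σℤ-* : ∀ n c (f : Fin n → ℤ) → Σℤ n (λ i → c * f i) ≡ c * Σℤ n f
Σℤ-* zero    c f = sym (ZP.*-zeroʳ c)
Σℤ-* (suc n) c f = trans (cong (_+_ (c * f zero)) (Σℤ-* n c _)) (sym (ZP.*-distribˡ-+ c _ _))

Σℤ-zero : ∀ n → Σℤ n (λ _ → + 0) ≡ + 0
Σℤ-zero zero    = refl
Σℤ-zero (suc n) = trans (ZP.+-identityˡ _) (Σℤ-zero n)

δ : ∀ {n} → Fin n → Fin n → ℤ
δ zero    zero    = + 1
δ zero    (suc _) = + 0
δ (suc _) zero    = + 0
δ (suc i) (suc k) = δ i k

δ-diag : ∀ {n} (i : Fin n) → δ i i ≡ + 1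
δ-diag zero    = refl
δ-diag (suc i) = δ-diag i

δ-off : ∀ {n} (i k : Fin n) → i ≢ k → δ i k ≡ + 0
δ-off zero    zero    i≢k = ⊥-elim (i≢k refl)
δ-off zero    (suc k) _   = refl
δ-off (suc i) zero    _   = refl
δ-off (suc i) (suc k) i≢k = δ-off i k (λ i≡k → i≢k (cong suc i≡k))

δ-nonneg : ∀ {n} (i k : Fin n) → + 0 Z.≤ δ i k
δ-nonneg zero    zero    = Z.+≤+ z≤n
δ-nonneg zero    (suc k) = Z.+≤+ z≤n
δ-nonneg (suc i) zero    = Z.+≤+ z≤n
δ-nonneg (suc i) (suc k) = δ-nonneg i k

Σℤ-δ : ∀ n (f : Fin n → ℤ) i → Σℤ n (λ k → f k * δ i k) ≡ f i
Σℤ-δ (suc n) f zero = begin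
  f zero * + 1 + Σℤ n (λ k → f (suc k) * + 0)
    ≡⟨ cong₂ _+_ (ZP.*-identityʳ (f zero))
                 (trans (Σℤ-cong n (λ k → ZP.*-zeroʳ (f (suc k)))) (Σℤ-zero n)) ⟩
  f zero + + 0
    ≡⟨ ZP.+-identityʳ _ ⟩
  f zero ∎
  where open ≡-Reasoning
Σℤ-δ (suc n) f (suc i) =
  trans (cong₂ _+_ (ZP.*-zeroʳ (f zero)) (Σℤ-δ n (λ k → f (suc k)) i)) (ZP.+-identityˡ _)

-- Least-element principle, double negated: a nonempty predicate on a type
-- with a ℕ-valued measure has a μ-minimal witness.  Every use below has goal
-- ⊥, so the double negation is harmless.

¬¬-minimise : {A : Set} (μ : A → ℕ) {P : A → Set} {a : A} → P a →
              ¬ ¬ (Σ A λ b → P b × (∀ c → P c → μ b N.≤ μ c))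
¬¬-minimise {A} μ {P} {a} pa noMin = below (μ a) a pa NP.≤-refl
  where
  below : ∀ B b → P b → μ b N.≤ B → ⊥
  below zero    b pb μb≤0 = noMin (b , pb , λ c _ → NP.≤-trans μb≤0 z≤n)
  below (suc B) b pb μb≤B = noMin (b , pb , minimal)
    where
    minimal : ∀ c → P c → μ b N.≤ μ c
    minimal c pc with μ b N.≤? μ c
    ... | yes μb≤μc = μb≤μc
    ... | no  μb≰μc =
      ⊥-elim (below B c pc (NP.≤-pred (NP.<-≤-trans (NP.≰⇒> μb≰μc) μb≤B)))

-- Fix simple roots αₛ, αₜ with c = A s t and c' = A t s, and
-- encode a word in {sₛ, sₜ} as a list of Booleans (false = sₛ, true = sₜ).
-- Applying the word y to a vector x with ⟨αₛ^∨,x⟩ = p and ⟨αₜ^∨,x⟩ = q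
-- yields x + a αₛ + b αₜ where (a , b) = coeffs c c' p q y; the two steps
-- are the simple reflections written in these coordinates.

reflectS : ℤ → ℤ → ℤ × ℤ → ℤ × ℤ
reflectS c p (a , b) = (- a - p - c * b , b)

reflectT : ℤ → ℤ → ℤ × ℤ → ℤ × ℤ
reflectT c' q (a , b) = (a , - b - q - c' * a)

coeffs : (c c' p q : ℤ) → List Bool → ℤ × ℤ
coeffs c c' p q []          = (+ 0 , + 0)
coeffs c c' p q (false ∷ y) = reflectS c p (coeffs c c' p q y)
coeffs c c' p q (true ∷ y)  = reflectT c' q (coeffs c c' p q y)

combine : ℤ → ℤ → ℤ × ℤ → ℤ × ℤ → ℤ × ℤ
combine p q (a₁ , b₁) (a₂ , b₂) = (p * a₁ + q * a₂ , p * b₁ + q * b₂)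

-- The coefficients depend linearly on (p , q), so identities between them
-- need only be checked for (1 , 0) and (0 , 1).

coeffs-linear : ∀ c c' p q y →
  coeffs c c' p q y ≡ combine p q (coeffs c c' (+ 1) (+ 0) y) (coeffs c c' (+ 0) (+ 1) y)
coeffs-linear c c' p q [] = cong₂ _,_ (zero-comb p q) (zero-comb p q)
  where
  zero-comb : ∀ p q → + 0 ≡ p * + 0 + q * + 0
  zero-comb = solve-∀
coeffs-linear c c' p q (false ∷ y) =
  trans (cong (reflectS c p) (coeffs-linear c c' p q y)) (cong₂ _,_ (stepS c p q _ _ _ _) refl)
  where
  stepS : ∀ c p q a₁ b₁ a₂ b₂ → - (p * a₁ + q * a₂) - p - c * (p * b₁ + q * b₂)
                         ≡ p * (- a₁ - + 1 - c * b₁) + q * (- a₂ - + 0 - c * b₂)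
  stepS = solve-∀
coeffs-linear c c' p q (true ∷ y) =
  trans (cong (reflectT c' q) (coeffs-linear c c' p q y)) (cong₂ _,_ refl (stepT c' p q _ _ _ _))
  where
  stepT : ∀ c' p q a₁ b₁ a₂ b₂ → - (p * b₁ + q * b₂) - q - c' * (p * a₁ + q * a₂)
                         ≡ p * (- b₁ - + 0 - c' * a₁) + q * (- b₂ - + 1 - c' * a₂)
  stepT = solve-∀

alt : Bool → ℕ → List Bool
alt b zero    = []
alt b (suc k) = b ∷ alt (not b) k

flips : ℕ → Bool → Bool
flips zero    b = b
flips (suc k) b = flips k (not b)

length-alt : ∀ b k → length (alt b k) ≡ k
length-alt b zero    = refl
length-alt b (suc k) = cong suc (length-alt (not b) k)

alt-snoc : ∀ b k → alt b (suc k) ≡ alt b k ++ flips k b ∷ []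
alt-snoc b zero    = refl
alt-snoc b (suc k) = cong (b ∷_) (alt-snoc (not b) k)

alt-+ : ∀ b j m → alt b (j N.+ m) ≡ alt b j ++ alt (flips j b) m
alt-+ b zero    m = refl
alt-+ b (suc j) m = cong (b ∷_) (alt-+ (not b) j m)

flips-not : ∀ k b → flips k (not b) ≡ not (flips k b)
flips-not zero    b = refl
flips-not (suc k) b = flips-not k (not b)

flips-+ : ∀ j m b → flips (j N.+ m) b ≡ flips m (flips j b)
flips-+ zero    m b = refl
flips-+ (suc j) m b = flips-+ j m (not b)

flips-involutive : ∀ k b → flips k (flips k b) ≡ b
flips-involutive zero    b = refl
flips-involutive (suc k) b = begin
  flips k (not (flips k (not b))) ≡⟨ cong (flips k) (sym (flips-not k (not b))) ⟩
  flips k (flips k (not (not b))) ≡⟨ flips-involutive k (not (not b)) ⟩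
  not (not b)                     ≡⟨ Data.Bool.Properties.not-involutive b ⟩
  b                               ∎
  where open ≡-Reasoning

HasSquare : List Bool → Set
HasSquare y = Σ (List Bool) λ y₁ → Σ (List Bool) λ y₂ → Σ Bool λ b → y ≡ y₁ ++ b ∷ b ∷ y₂

data Shape (y : List Bool) : Set where
  empty       : y ≡ [] → Shape y
  alternating : ∀ b k → y ≡ alt b (suc k) → Shape y
  square      : HasSquare y → Shape y

shape : ∀ y → Shape y
shape [] = empty refl
shape (b ∷ y) with shape y
... | empty refl                  = alternating b 0 refl
... | square (y₁ , y₂ , c , refl) = square (b ∷ y₁ , y₂ , c , refl)
... | alternating c k refl        = prepend b c
  where
  prepend : ∀ b c → Shape (b ∷ alt c (suc k))
  prepend false true  = alternating false (suc k) refl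
  prepend true  false = alternating true (suc k) refl
  prepend false false = square ([] , alt true k , false , refl)
  prepend true  true  = square ([] , alt false k , true , refl)

Braid : ℤ → ℤ → ℕ → Set
Braid c c' m = ∀ p q b → coeffs c c' p q (alt b m) ≡ coeffs c c' p q (alt (not b) m)

braid-from-basis : ∀ c c' m →
  coeffs c c' (+ 1) (+ 0) (alt true m) ≡ coeffs c c' (+ 1) (+ 0) (alt false m) →
  coeffs c c' (+ 0) (+ 1) (alt true m) ≡ coeffs c c' (+ 0) (+ 1) (alt false m) →
  Braid c c' m
braid-from-basis c c' m on-αₛ∨ on-αₜ∨ p q true =
  trans (coeffs-linear c c' p q _)
        (trans (cong₂ (combine p q) on-αₛ∨ on-αₜ∨) (sym (coeffs-linear c c' p q _)))
braid-from-basis c c' m on-αₛ∨ on-αₜ∨ p q false =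
  sym (braid-from-basis c c' m on-αₛ∨ on-αₜ∨ p q true)

-- A word acting on αₛ (so p = 2, q = c') gives (1 + a) αₛ + b αₜ; the
-- result is a positive root when both coefficients are nonnegative.  The
-- alternating word alt (flips k true) (suc k) is the one of length k + 1
-- ending in sₜ.

NonnegCoeffs : ℤ × ℤ → Set
NonnegCoeffs (a , b) = (+ 0 Z.≤ + 1 + a) × (+ 0 Z.≤ b)

nonnegCoeffs? : ∀ r → Dec (NonnegCoeffs r)
nonnegCoeffs? (a , b) = (+ 0 Z.≤? + 1 + a) ×-dec (+ 0 Z.≤? b)

PositiveDihedralRoot : ℤ → ℤ → ℕ → Set
PositiveDihedralRoot c c' k = NonnegCoeffs (coeffs c c' (+ 2) c' (alt (flips k true) (suc k)))

-- What the positivity theorem needs from a rank-two subsystem: a braid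
-- relation of length m + 1, and positivity of sₜ-ending alternating words of
-- length at most m on αₛ.

record Dihedral (c c' : ℤ) : Set where
  field
    m        : ℕ
    braid    : Braid c c' (suc m)
    positive : ∀ {k} → k N.< m → PositiveDihedralRoot c c' k

data Rank2Type : ℤ → ℤ → Set where
  A₁×A₁ : Rank2Type (+ 0) (+ 0)
  A₂    : Rank2Type -[1+ 0 ] -[1+ 0 ]
  B₂    : Rank2Type -[1+ 0 ] -[1+ 1 ]
  B₂'   : Rank2Type -[1+ 1 ] -[1+ 0 ]
  G₂    : Rank2Type -[1+ 0 ] -[1+ 2 ]
  G₂'   : Rank2Type -[1+ 2 ] -[1+ 0 ]

rank2-type : ∀ c c' → c Z.≤ + 0 → c' Z.≤ + 0 → (c ≡ + 0 → c' ≡ + 0) → (c' ≡ + 0 → c ≡ + 0) →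
             c * c' Z.< + 4 → Rank2Type c c'
rank2-type (+ zero)   c'         _          _          c≡0 _   _ rewrite c≡0 refl = A₁×A₁
rank2-type +[1+ a ]   c'         (Z.+≤+ ()) _          _   _   _
rank2-type -[1+ a ]   (+ zero)   _          _          _   c'≡0 _ with c'≡0 refl
... | ()
rank2-type -[1+ a ]   +[1+ b ]   _          (Z.+≤+ ()) _   _   _
rank2-type -[1+ a ]   -[1+ b ]   _          _          _   _   (Z.+<+ ab<4) =
  small a b (subst (N._< 4) (NP.*-comm (suc a) (suc b)) ab<4)
  where
  small : ∀ a b → suc b N.* suc a N.< 4 → Rank2Type -[1+ a ] -[1+ b ]
  small 0 0 _ = A₂
  small 0 1 _ = B₂
  small 0 2 _ = G₂
  small 1 0 _ = B₂'
  small 2 0 _ = G₂'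
  small 0 (suc (suc (suc b))) (s≤s (s≤s (s≤s (s≤s ()))))
  small 1 (suc b)             (s≤s (s≤s (s≤s (s≤s ()))))
  small 2 (suc b)             (s≤s (s≤s (s≤s (s≤s ()))))
  small (suc (suc (suc a))) b (s≤s (s≤s (s≤s (s≤s ()))))

-- Each finite rank-two type has the data above (braid lengths 2, 3, 4, 6),
-- checked by evaluation: the braid relation on the two coordinate
-- functionals, and positivity by a decision procedure.

positive? : ∀ c c' m → Dec (∀ {k} → k N.< m → PositiveDihedralRoot c c' k)
positive? c c' =
  NP.allUpTo? (λ k → nonnegCoeffs? (coeffs c c' (+ 2) c' (alt (flips k true) (suc k))))

certify : ∀ {c c'} m →
  coeffs c c' (+ 1) (+ 0) (alt true (suc m)) ≡ coeffs c c' (+ 1) (+ 0) (alt false (suc m)) →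
  coeffs c c' (+ 0) (+ 1) (alt true (suc m)) ≡ coeffs c c' (+ 0) (+ 1) (alt false (suc m)) →
  True (positive? c c' m) → Dihedral c c'
certify {c} {c'} m on-αₛ∨ on-αₜ∨ ok = record
  { m        = m
  ; braid    = braid-from-basis c c' (suc m) on-αₛ∨ on-αₜ∨
  ; positive = toWitness {a? = positive? c c' m} ok
  }

dihedral : ∀ {c c'} → Rank2Type c c' → Dihedral c c'
dihedral A₁×A₁ = certify 1 refl refl _
dihedral A₂    = certify 2 refl refl _
dihedral B₂    = certify 3 refl refl _
dihedral B₂'   = certify 3 refl refl _
dihedral G₂    = certify 5 refl refl _
dihedral G₂'   = certify 5 refl refl _

module WeylGroup {n : ℕ} (C : CartanMatrix n) where
  open CartanMatrix C
  open RootSystem C renaming (refl to reflect)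

  _≐_ : Vec n → Vec n → Set
  x ≐ y = ∀ k → x k ≡ y k

  ≡⇒≐ : ∀ {x y : Vec n} → x ≡ y → x ≐ y
  ≡⇒≐ refl k = refl

  ⟪_,_⟫ : Fin n → Vec n → ℤ
  ⟪ i , x ⟫ = Σℤ n (λ k → A i k * x k)

  lin : ℤ → Vec n → ℤ → Vec n → Vec n
  lin a x b y k = a * x k + b * y k

  e≡δ : ∀ i k → e i k ≡ δ i k
  e≡δ i k with i ≟ k
  ... | yes refl = sym (δ-diag i)
  ... | no  i≢k  = sym (δ-off i k i≢k)

  e-diag : ∀ i → e i i ≡ + 1
  e-diag i = trans (e≡δ i i) (δ-diag i)

  e-off : ∀ i k → i ≢ k → e i k ≡ + 0
  e-off i k i≢k = trans (e≡δ i k) (δ-off i k i≢k)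

  Σℤ-e : ∀ (f : Fin n → ℤ) i → Σℤ n (λ k → f k * e i k) ≡ f i
  Σℤ-e f i = trans (Σℤ-cong n (λ k → cong (f k *_) (e≡δ i k))) (Σℤ-δ n f i)

  Σℤ-lin-e : ∀ (f : Fin n → ℤ) s t a b → Σℤ n (λ k → f k * lin a (e s) b (e t) k) ≡ a * f s + b * f t
  Σℤ-lin-e f s t a b = begin
    Σℤ n (λ k → f k * (a * e s k + b * e t k))
      ≡⟨ Σℤ-cong n (λ k → distrib (f k) a b (e s k) (e t k)) ⟩
    Σℤ n (λ k → a * (f k * e s k) + b * (f k * e t k))
      ≡⟨ Σℤ-+ n _ _ ⟩
    Σℤ n (λ k → a * (f k * e s k)) + Σℤ n (λ k → b * (f k * e t k))
      ≡⟨ cong₂ _+_ (trans (Σℤ-* n a _) (cong (a *_) (Σℤ-e f s)))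
                   (trans (Σℤ-* n b _) (cong (b *_) (Σℤ-e f t))) ⟩
    a * f s + b * f t ∎
    where
    open ≡-Reasoning
    distrib : ∀ g a b u v → g * (a * u + b * v) ≡ a * (g * u) + b * (g * v)
    distrib = solve-∀

  pair-e : ∀ i j → ⟪ i , e j ⟫ ≡ A i j
  pair-e i = Σℤ-e (A i)

  pair-cong : ∀ i {x y} → x ≐ y → ⟪ i , x ⟫ ≡ ⟪ i , y ⟫
  pair-cong i x≐y = Σℤ-cong n (λ k → cong (A i k *_) (x≐y k))

  pair-lin : ∀ i a x b y → ⟪ i , lin a x b y ⟫ ≡ a * ⟪ i , x ⟫ + b * ⟪ i , y ⟫
  pair-lin i a x b y = begin
    Σℤ n (λ k → A i k * (a * x k + b * y k))
      ≡⟨ Σℤ-cong n (λ k → distrib (A i k) a (x k) b (y k)) ⟩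
    Σℤ n (λ k → a * (A i k * x k) + b * (A i k * y k))
      ≡⟨ Σℤ-+ n _ _ ⟩
    Σℤ n (λ k → a * (A i k * x k)) + Σℤ n (λ k → b * (A i k * y k))
      ≡⟨ cong₂ _+_ (Σℤ-* n a _) (Σℤ-* n b _) ⟩
    a * ⟪ i , x ⟫ + b * ⟪ i , y ⟫ ∎
    where
    open ≡-Reasoning
    distrib : ∀ g a u b v → g * (a * u + b * v) ≡ a * (g * u) + b * (g * v)
    distrib = solve-∀

  pair-zero : ∀ i → ⟪ i , (λ _ → + 0) ⟫ ≡ + 0
  pair-zero i = trans (Σℤ-cong n (λ k → ZP.*-zeroʳ (A i k))) (Σℤ-zero n)

  reflect-cong : ∀ i {x y} → x ≐ y → reflect i x ≐ reflect i y
  reflect-cong i x≐y k = cong₂ _-_ (x≐y k) (cong (_* e i k) (pair-cong i x≐y))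

  reflect-lin : ∀ i a x b y → reflect i (lin a x b y) ≐ lin a (reflect i x) b (reflect i y)
  reflect-lin i a x b y k =
    trans (cong (λ p → lin a x b y k - p * e i k) (pair-lin i a x b y))
          (regroup a (x k) b (y k) ⟪ i , x ⟫ ⟪ i , y ⟫ (e i k))
    where
    regroup : ∀ a x b y p q u → (a * x + b * y) - (a * p + b * q) * u ≡ a * (x - p * u) + b * (y - q * u)
    regroup = solve-∀

  reflect-e : ∀ i → reflect i (e i) ≐ neg (e i)
  reflect-e i k =
    trans (cong (λ p → e i k - p * e i k) (trans (pair-e i i) (diag i))) (minus-twice (e i k))
    where
    minus-twice : ∀ u → u - + 2 * u ≡ - u
    minus-twice = solve-∀

  reflect-involutive : ∀ i x → reflect i (reflect i x) ≐ x
  reflect-involutive i x k =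
    trans (cong (λ p → reflect i x k - p * e i k) pair-sx) (cancel (x k) ⟪ i , x ⟫ (e i k))
    where
    pair-sx : ⟪ i , reflect i x ⟫ ≡ + 1 * ⟪ i , x ⟫ + (- ⟪ i , x ⟫) * + 2
    pair-sx = begin
      ⟪ i , reflect i x ⟫
        ≡⟨ pair-cong i (λ k → as-lin (x k) ⟪ i , x ⟫ (e i k)) ⟩
      ⟪ i , lin (+ 1) x (- ⟪ i , x ⟫) (e i) ⟫
        ≡⟨ pair-lin i (+ 1) x (- ⟪ i , x ⟫) (e i) ⟩
      + 1 * ⟪ i , x ⟫ + (- ⟪ i , x ⟫) * ⟪ i , e i ⟫
        ≡⟨ cong (λ a → + 1 * ⟪ i , x ⟫ + (- ⟪ i , x ⟫) * a) (trans (pair-e i i) (diag i)) ⟩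
      + 1 * ⟪ i , x ⟫ + (- ⟪ i , x ⟫) * + 2 ∎
      where
      open ≡-Reasoning
      as-lin : ∀ u p v → u - p * v ≡ + 1 * u + (- p) * v
      as-lin = solve-∀
    cancel : ∀ u p v → u - p * v - (+ 1 * p + (- p) * + 2) * v ≡ u
    cancel = solve-∀

  reflect-zero : ∀ i → reflect i (λ _ → + 0) ≐ (λ _ → + 0)
  reflect-zero i k = cong (λ p → + 0 - p * e i k) (pair-zero i)

  act-cong : ∀ w {x y} → x ≐ y → act w x ≐ act w y
  act-cong []      x≐y = x≐y
  act-cong (i ∷ w) x≐y = reflect-cong i (act-cong w x≐y)

  act-lin : ∀ w a x b y → act w (lin a x b y) ≐ lin a (act w x) b (act w y)
  act-lin []      a x b y k = refl
  act-lin (i ∷ w) a x b y k = trans (reflect-cong i (act-lin w a x b y) k) (reflect-lin i a _ b _ k)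

  act-++ : ∀ u v x → act (u ++ v) x ≡ act u (act v x)
  act-++ []      v x = refl
  act-++ (i ∷ u) v x = cong (reflect i) (act-++ u v x)

  act-neg : ∀ w x → act w (neg x) ≐ neg (act w x)
  act-neg w x k =
    trans (act-cong w (λ j → neg-as-lin (x j)) k)
          (trans (act-lin w -[1+ 0 ] x (+ 0) x k) (sym (neg-as-lin (act w x k))))
    where
    neg-as-lin : ∀ u → - u ≡ -[1+ 0 ] * u + + 0 * u
    neg-as-lin = solve-∀

  act-snoc-e : ∀ u s → act (u ∷ʳ s) (e s) ≐ neg (act u (e s))
  act-snoc-e u s k =
    trans (≡⇒≐ (act-++ u (s ∷ []) (e s)) k) (trans (act-cong u (reflect-e s) k) (act-neg u (e s) k))

  act-kernel : ∀ w x → act w x ≐ (λ _ → + 0) → x ≐ (λ _ → + 0)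
  act-kernel []      x wx≐0 = wx≐0
  act-kernel (i ∷ w) x wx≐0 = act-kernel w x λ k →
    trans (sym (reflect-involutive i (act w x) k))
          (trans (reflect-cong i wx≐0 k) (reflect-zero i k))

  -- Words are equivalent when they act identically, i.e. represent the
  -- same element of W.

  infix 4 _≈_

  record _≈_ (u v : Word) : Set where
    constructor mk≈
    field run : ∀ x → act u x ≐ act v x
  open _≈_

  ≈-refl : ∀ {u} → u ≈ u
  ≈-refl = mk≈ (λ x k → refl)

  ≈-sym : ∀ {u v} → u ≈ v → v ≈ u
  ≈-sym u≈v = mk≈ (λ x k → sym (run u≈v x k))

  ≈-trans : ∀ {u v t} → u ≈ v → v ≈ t → u ≈ t
  ≈-trans u≈v v≈t = mk≈ (λ x k → trans (run u≈v x k) (run v≈t x k))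

  ≈-setoid : Setoid _ _
  ≈-setoid = record
    { Carrier = Word ; _≈_ = _≈_
    ; isEquivalence = record { refl = ≈-refl ; sym = ≈-sym ; trans = ≈-trans } }

  module ≈-Reasoning = Relation.Binary.Reasoning.Setoid ≈-setoid

  ≡⇒≈ : ∀ {u v} → u ≡ v → u ≈ v
  ≡⇒≈ refl = ≈-refl

  ≈-++ : ∀ {u u' v v'} → u ≈ u' → v ≈ v' → (u ++ v) ≈ (u' ++ v')
  ≈-++ {u} {u'} {v} {v'} u≈u' v≈v' = mk≈ λ x k → begin
    act (u ++ v) x k    ≡⟨ ≡⇒≐ (act-++ u v x) k ⟩
    act u (act v x) k   ≡⟨ act-cong u (run v≈v' x) k ⟩
    act u (act v' x) k  ≡⟨ run u≈u' (act v' x) k ⟩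
    act u' (act v' x) k ≡⟨ ≡⇒≐ (sym (act-++ u' v' x)) k ⟩
    act (u' ++ v') x k  ∎
    where open ≡-Reasoning

  square≈[] : ∀ i → (i ∷ i ∷ []) ≈ []
  square≈[] i = mk≈ (reflect-involutive i)

  snoc-snoc≈ : ∀ v i → ((v ++ i ∷ []) ++ i ∷ []) ≈ v
  snoc-snoc≈ v i = begin
    (v ++ i ∷ []) ++ i ∷ [] ≡⟨ ++-assoc v (i ∷ []) (i ∷ []) ⟩
    v ++ i ∷ i ∷ []         ≈⟨ ≈-++ (≈-refl {v}) (square≈[] i) ⟩
    v ++ []                 ≡⟨ ++-identityʳ v ⟩
    v                       ∎
    where open ≈-Reasoning

  -- w is reduced when no equivalent word is shorter; w has no descent at
  -- sₛ when no expression of w sₛ is shorter than w, i.e. ℓ(w sₛ) ≥ ℓ(w).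

  Reduced : Word → Set
  Reduced w = ∀ v → v ≈ w → length w N.≤ length v

  NoDescent : Word → Fin n → Set
  NoDescent w s = ∀ v → v ≈ (w ++ s ∷ []) → length w N.≤ length v

  reduced-expression : ∀ w → ¬ ¬ (Σ Word λ v → v ≈ w × Reduced v)
  reduced-expression w noReduced = ¬¬-minimise length (≈-refl {w}) λ where
    (v , v≈w , minimal) → noReduced (v , v≈w , λ u u≈v → minimal u (≈-trans u≈v v≈w))

  letter : Fin n → Fin n → Bool → Fin n
  letter s t false = s
  letter s t true  = t

  word : Fin n → Fin n → List Bool → Word
  word s t = map (letter s t)

  word-++ : ∀ s t y₁ y₂ → word s t (y₁ ++ y₂) ≡ word s t y₁ ++ word s t y₂
  word-++ s t = map-++ (letter s t)

  length-word : ∀ s t y → length (word s t y) ≡ length y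
  length-word s t = length-map (letter s t)

  shift : Fin n → Fin n → ℤ × ℤ → Vec n → Vec n
  shift s t (a , b) x k = x k + lin a (e s) b (e t) k

  pair-shift : ∀ i s t a b x → ⟪ i , shift s t (a , b) x ⟫ ≡ ⟪ i , x ⟫ + (a * A i s + b * A i t)
  pair-shift i s t a b x = begin
    Σℤ n (λ k → A i k * (x k + lin a (e s) b (e t) k))
      ≡⟨ Σℤ-cong n (λ k → ZP.*-distribˡ-+ (A i k) (x k) _) ⟩
    Σℤ n (λ k → A i k * x k + A i k * lin a (e s) b (e t) k)
      ≡⟨ Σℤ-+ n _ _ ⟩
    ⟪ i , x ⟫ + Σℤ n (λ k → A i k * lin a (e s) b (e t) k)
      ≡⟨ cong (_+_ ⟪ i , x ⟫) (Σℤ-lin-e (A i) s t a b) ⟩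
    ⟪ i , x ⟫ + (a * A i s + b * A i t) ∎
    where open ≡-Reasoning

  act-word : ∀ s t x y →
    act (word s t y) x ≐ shift s t (coeffs (A s t) (A t s) ⟪ s , x ⟫ ⟪ t , x ⟫ y) x
  act-word s t x [] k = sym (trans (cong (_+_ (x k)) (no-shift (e s k) (e t k))) (ZP.+-identityʳ (x k)))
    where
    no-shift : ∀ u v → + 0 * u + + 0 * v ≡ + 0
    no-shift = solve-∀
  act-word s t x (false ∷ y) k =
    trans (reflect-cong s (act-word s t x y) k)
          (trans (cong (λ p → shift s t (a , b) x k - p * e s k)
                       (trans (pair-shift s s t a b x) (cong₂ (λ u v → ⟪ s , x ⟫ + (a * u + b * v)) (diag s) refl)))
                 (step (x k) a b ⟪ s , x ⟫ (A s t) (e s k) (e t k)))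
    where
    a = proj₁ (coeffs (A s t) (A t s) ⟪ s , x ⟫ ⟪ t , x ⟫ y)
    b = proj₂ (coeffs (A s t) (A t s) ⟪ s , x ⟫ ⟪ t , x ⟫ y)
    step : ∀ x a b p c u v → x + (a * u + b * v) - (p + (a * + 2 + b * c)) * u
                           ≡ x + ((- a - p - c * b) * u + b * v)
    step = solve-∀
  act-word s t x (true ∷ y) k =
    trans (reflect-cong t (act-word s t x y) k)
          (trans (cong (λ q → shift s t (a , b) x k - q * e t k)
                       (trans (pair-shift t s t a b x) (cong₂ (λ u v → ⟪ t , x ⟫ + (a * u + b * v)) refl (diag t))))
                 (step (x k) a b ⟪ t , x ⟫ (A t s) (e s k) (e t k)))
    where
    a = proj₁ (coeffs (A s t) (A t s) ⟪ s , x ⟫ ⟪ t , x ⟫ y)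
    b = proj₂ (coeffs (A s t) (A t s) ⟪ s , x ⟫ ⟪ t , x ⟫ y)
    step : ∀ x a b q c' u v → x + (a * u + b * v) - (q + (a * c' + b * + 2)) * v
                            ≡ x + (a * u + (- b - q - c' * a) * v)
    step = solve-∀

  act-word-αₛ : ∀ s t y → act (word s t y) (e s) ≐
    lin (+ 1 + proj₁ (coeffs (A s t) (A t s) (+ 2) (A t s) y)) (e s)
        (proj₂ (coeffs (A s t) (A t s) (+ 2) (A t s) y)) (e t)
  act-word-αₛ s t y k =
    trans (act-word s t (e s) y k)
          (trans (cong (λ r → shift s t r (e s) k)
                       (cong₂ (λ p q → coeffs (A s t) (A t s) p q y) (trans (pair-e s s) (diag s)) (pair-e t s)))
                 (collect (e s k) (proj₁ r) (proj₂ r) (e t k)))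
    where
    r = coeffs (A s t) (A t s) (+ 2) (A t s) y
    collect : ∀ u a b v → u + (a * u + b * v) ≡ (+ 1 + a) * u + b * v
    collect = solve-∀

  braid≈ : ∀ s t m → Braid (A s t) (A t s) m → ∀ b → word s t (alt b m) ≈ word s t (alt (not b) m)
  braid≈ s t m braid b = mk≈ λ x k →
    trans (act-word s t x (alt b m) k)
          (trans (cong (λ r → shift s t r x k) (braid ⟪ s , x ⟫ ⟪ t , x ⟫ b))
                 (sym (act-word s t x (alt (not b) m) k)))

  -- Positive definiteness on the vector 2αₜ - A s t αₛ forces
  -- A s t · A t s < 4, so every pair of distinct simple roots spans a
  -- finite rank-two subsystem.

  quadratic-form : Vec n → ℤ
  quadratic-form x = Σℤ n (λ i → Σℤ n (λ j → x i * ((+ d i) * A i j) * x j))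

  form-rank2 : ∀ s t → quadratic-form (lin (- A s t) (e s) (+ 2) (e t))
                       ≡ + d t * (+ 2 * (+ 4 - A s t * A t s))
  form-rank2 s t = begin
    Σℤ n (λ i → Σℤ n (λ j → x i * D i j * x j))
      ≡⟨ Σℤ-cong n (λ i → Σℤ-lin-e (λ j → x i * D i j) s t (- c) (+ 2)) ⟩
    Σℤ n (λ i → (- c) * (x i * D i s) + + 2 * (x i * D i t))
      ≡⟨ Σℤ-cong n (λ i → collect c (x i) (D i s) (D i t)) ⟩
    Σℤ n (λ i → ((- c) * D i s + + 2 * D i t) * x i)
      ≡⟨ Σℤ-lin-e (λ i → (- c) * D i s + + 2 * D i t) s t (- c) (+ 2) ⟩
    (- c) * ((- c) * D s s + + 2 * D s t) + + 2 * ((- c) * D t s + + 2 * D t t)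
      ≡⟨ cong₂ (λ u v → (- c) * ((- c) * (+ d s * u) + + 2 * D s t) + + 2 * ((- c) * D t s + + 2 * (+ d t * v)))
               (diag s) (diag t) ⟩
    (- c) * ((- c) * (+ d s * + 2) + + 2 * (+ d s * c)) + + 2 * ((- c) * (+ d t * c') + + 2 * (+ d t * + 2))
      ≡⟨ evaluate c c' (+ d s) (+ d t) ⟩
    + d t * (+ 2 * (+ 4 - c * c')) ∎
    where
    open ≡-Reasoning
    c  = A s t
    c' = A t s
    x  = lin (- A s t) (e s) (+ 2) (e t)
    D : Fin n → Fin n → ℤ
    D i j = + d i * A i j
    collect : ∀ c u v w → (- c) * (u * v) + + 2 * (u * w) ≡ ((- c) * v + + 2 * w) * u
    collect = solve-∀
    evaluate : ∀ c c' ds dt → (- c) * ((- c) * (ds * + 2) + + 2 * (ds * c)) + + 2 * ((- c) * (dt * c') + + 2 * (dt * + 2))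
                            ≡ dt * (+ 2 * (+ 4 - c * c'))
    evaluate = solve-∀

  cartan-product<4 : ∀ s t → s ≢ t → A s t * A t s Z.< + 4
  cartan-product<4 s t s≢t = subst₂ Z._<_ (zero-+ P) (cancel P) (ZP.+-monoˡ-< P 0<4-P)
    where
    P = A s t * A t s
    x = lin (- A s t) (e s) (+ 2) (e t)
    x≢0 : ¬ (∀ k → x k ≡ + 0)
    x≢0 x≡0 with trans (sym (coordinate-t (A s t)))
                       (trans (cong₂ (λ u v → (- A s t) * u + + 2 * v) (sym (e-off s t s≢t)) (sym (e-diag t)))
                              (x≡0 t))
      where
      coordinate-t : ∀ c → (- c) * + 0 + + 2 * + 1 ≡ + 2
      coordinate-t = solve-∀
    ... | ()
    0<form : + 0 Z.< + d t * (+ 2 * (+ 4 - P))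
    0<form = subst (+ 0 Z.<_) (form-rank2 s t) (posdef x x≢0)
    0<4-P : + 0 Z.< + 4 - P
    0<4-P = ZP.*-cancelˡ-<-nonNeg (+ 2) (subst (Z._< + 2 * (+ 4 - P)) (sym (ZP.*-zeroʳ (+ 2)))
              (ZP.*-cancelˡ-<-nonNeg (+ d t)
                (subst (Z._< + d t * (+ 2 * (+ 4 - P))) (sym (ZP.*-zeroʳ (+ d t))) 0<form)))
    zero-+ : ∀ P → + 0 + P ≡ P
    zero-+ = solve-∀
    cancel : ∀ P → (+ 4 - P) + P ≡ + 4
    cancel = solve-∀

  rank2 : ∀ s t → s ≢ t → Rank2Type (A s t) (A t s)
  rank2 s t s≢t = rank2-type (A s t) (A t s) (offdiag s t s≢t) (offdiag t s (λ t≡s → s≢t (sym t≡s)))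
                    (zero-sym s t) (zero-sym t s) (cartan-product<4 s t s≢t)

  -- An alternating word longer than the braid length can be rewritten, by a
  -- braid move on its last suc m letters, into a word of the same length
  -- whose last letter is flipped.
  braid-flip-last : ∀ s t m → Braid (A s t) (A t s) (suc m) → ∀ b k → m N.≤ k →
    Σ (List Bool) λ z → length z ≡ k × word s t (alt b (suc k)) ≈ word s t (z ++ not (flips k b) ∷ [])
  braid-flip-last s t m braid b k m≤k = z , |z|≡k , (begin
    W (alt b (suc k))                       ≡⟨ cong (W ∘ alt b) (sym j+1+m≡1+k) ⟩
    W (alt b (j N.+ suc m))                 ≡⟨ cong W (alt-+ b j (suc m)) ⟩
    W (alt b j ++ alt b₁ (suc m))           ≡⟨ word-++ s t (alt b j) (alt b₁ (suc m)) ⟩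
    W (alt b j) ++ W (alt b₁ (suc m))       ≈⟨ ≈-++ (≈-refl {W (alt b j)}) (braid≈ s t (suc m) braid b₁) ⟩
    W (alt b j) ++ W (alt (not b₁) (suc m)) ≡⟨ sym (word-++ s t (alt b j) (alt (not b₁) (suc m))) ⟩
    W (alt b j ++ alt (not b₁) (suc m))     ≡⟨ cong (λ u → W (alt b j ++ u)) (alt-snoc (not b₁) m) ⟩
    W (alt b j ++ alt (not b₁) m ++ flips m (not b₁) ∷ [])
                                            ≡⟨ cong (λ l → W (alt b j ++ alt (not b₁) m ++ l ∷ [])) last-letter ⟩
    W (alt b j ++ alt (not b₁) m ++ not (flips k b) ∷ [])
                                            ≡⟨ cong W (sym (++-assoc (alt b j) (alt (not b₁) m) _)) ⟩
    W (z ++ not (flips k b) ∷ [])           ∎)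
    where
    open ≈-Reasoning
    W = word s t
    j  = k N.∸ m
    b₁ = flips j b
    z  = alt b j ++ alt (not b₁) m
    j+m≡k : j N.+ m ≡ k
    j+m≡k = NP.m∸n+n≡m m≤k
    j+1+m≡1+k : j N.+ suc m ≡ suc k
    j+1+m≡1+k = trans (NP.+-suc j m) (cong suc j+m≡k)
    |z|≡k : length z ≡ k
    |z|≡k = trans (length-++ (alt b j)) (trans (cong₂ N._+_ (length-alt b j) (length-alt (not b₁) m)) j+m≡k)
    last-letter : flips m (not b₁) ≡ not (flips k b)
    last-letter = trans (flips-not m b₁) (cong not (trans (sym (flips-+ j m b)) (cong (λ l → flips l b) j+m≡k)))

  Nonneg Nonpos : Vec n → Set
  Nonneg x = ∀ k → + 0 Z.≤ x k
  Nonpos x = ∀ k → x k Z.≤ + 0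

  nonneg? : ∀ x → Dec (Nonneg x)
  nonneg? x = all? (λ k → + 0 Z.≤? x k)

  nonpos? : ∀ x → Dec (Nonpos x)
  nonpos? x = all? (λ k → x k Z.≤? + 0)

  nonneg-e : ∀ s → Nonneg (e s)
  nonneg-e s k = subst (+ 0 Z.≤_) (sym (e≡δ s k)) (δ-nonneg s k)

  nonneg-lin : ∀ {a x b y} → + 0 Z.≤ a → Nonneg x → + 0 Z.≤ b → Nonneg y → Nonneg (lin a x b y)
  nonneg-lin a≥0 x≥0 b≥0 y≥0 k = ZP.+-mono-≤ (nonneg-* a≥0 (x≥0 k)) (nonneg-* b≥0 (y≥0 k))
    where
    nonneg-* : ∀ {a b} → + 0 Z.≤ a → + 0 Z.≤ b → + 0 Z.≤ a * b
    nonneg-* {+ a} {+ b} _ _ = subst (+ 0 Z.≤_) (ZP.pos-* a b) (Z.+≤+ z≤n)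

  PositivityUpTo : ℕ → Set
  PositivityUpTo L = ∀ x → length x N.≤ L → Reduced x → ∀ s → NoDescent x s → Nonneg (act x (e s))

  Factorisation : Word → Fin n → Fin n → Word × List Bool → Set
  Factorisation w s t (x , y) = (x ++ word s t y) ≈ w × length x N.+ length y ≡ length w

  -- The inductive step: w is reduced without descent at sₛ, and w = x · y is
  -- a factorisation with x as short as possible.  Minimality makes x
  -- reduced without descent at sₛ or sₜ, so x αₛ, x αₜ ≥ 0 by induction;
  -- and y is reduced in ⟨sₛ,sₜ⟩ without descent at sₛ, so the rank-two data
  -- give y αₛ = a αₛ + b αₜ with a, b ≥ 0.  Hence w αₛ = a x αₛ + b x αₜ ≥ 0.
  -- IH is the positivity theorem for shorter words, D the rank-two data.
  module MinimalFactorisation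
    {L : ℕ} (IH : PositivityUpTo L)
    {w : Word} {s t : Fin n} (D : Dihedral (A s t) (A t s)) (red : Reduced w) (nod : NoDescent w s)
    {x : Word} {y : List Bool} (fact : Factorisation w s t (x , y))
    (minimal : ∀ f → Factorisation w s t f → length x N.≤ length (proj₁ f))
    (|x|≤L : length x N.≤ L)
    where

    W : List Bool → Word
    W = word s t

    x·y≈w : (x ++ W y) ≈ w
    x·y≈w = proj₁ fact

    |x|+|y|≡|w| : length x N.+ length y ≡ length w
    |x|+|y|≡|w| = proj₂ fact

    length-x·W : ∀ x' y' → length (x' ++ W y') ≡ length x' N.+ length y'
    length-x·W x' y' = trans (length-++ x') (cong (length x' N.+_) (length-word s t y'))

    no-shortcut : ∀ z → length z N.< length y → length w N.≤ length (x ++ W z) → ⊥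
    no-shortcut z |z|<|y| |w|≤ = NP.<-irrefl refl (NP.≤-<-trans |w|≤ (begin-strict
      length (x ++ W z)    ≡⟨ length-x·W x z ⟩
      length x N.+ length z <⟨ NP.+-monoʳ-< (length x) |z|<|y| ⟩
      length x N.+ length y ≡⟨ |x|+|y|≡|w| ⟩
      length w             ∎))
      where open NP.≤-Reasoning

    x-reduced : Reduced x
    x-reduced v v≈x = NP.+-cancelʳ-≤ (length y) (length x) (length v) (begin
      length x N.+ length y ≡⟨ |x|+|y|≡|w| ⟩
      length w              ≤⟨ red (v ++ W y) (≈-trans (≈-++ v≈x (≈-refl {W y})) x·y≈w) ⟩
      length (v ++ W y)     ≡⟨ length-x·W v y ⟩
      length v N.+ length y ∎)
      where open NP.≤-Reasoning

    -- If ℓ(x σ) < ℓ(x) for a letter σ then (x σ) · (σ y) would be a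
    -- factorisation with a shorter first factor.
    x-no-descent : ∀ b → NoDescent x (letter s t b)
    x-no-descent b v v≈xσ with length x N.≤? length v
    ... | yes |x|≤|v| = |x|≤|v|
    ... | no  |x|≰|v| = ⊥-elim (|x|≰|v| (minimal (v , b ∷ y) (v·σy≈w , lengths)))
      where
      σ = letter s t b
      v·σy≈w : (v ++ W (b ∷ y)) ≈ w
      v·σy≈w = begin
        v ++ σ ∷ W y                     ≡⟨ sym (++-assoc v (σ ∷ []) (W y)) ⟩
        (v ++ σ ∷ []) ++ W y             ≈⟨ ≈-++ (≈-++ v≈xσ (≈-refl {σ ∷ []})) (≈-refl {W y}) ⟩
        ((x ++ σ ∷ []) ++ σ ∷ []) ++ W y ≈⟨ ≈-++ (snoc-snoc≈ x σ) (≈-refl {W y}) ⟩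
        x ++ W y                         ≈⟨ x·y≈w ⟩
        w                                ∎
        where open ≈-Reasoning
      lengths : length v N.+ length (b ∷ y) ≡ length w
      lengths = NP.≤-antisym
        (subst (N._≤ length w) (sym (NP.+-suc (length v) (length y)))
          (subst (suc (length v) N.+ length y N.≤_) |x|+|y|≡|w| (NP.+-monoˡ-≤ (length y) (NP.≰⇒> |x|≰|v|))))
        (subst (length w N.≤_) (length-x·W v (b ∷ y)) (red _ v·σy≈w))

    x-αₛ-positive : Nonneg (act x (e s))
    x-αₛ-positive = IH x |x|≤L x-reduced s (x-no-descent false)

    x-αₜ-positive : Nonneg (act x (e t))
    x-αₜ-positive = IH x |x|≤L x-reduced t (x-no-descent true)

    coeffs-y : ℤ × ℤ
    coeffs-y = coeffs (A s t) (A t s) (+ 2) (A t s) y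

    positive-if : NonnegCoeffs coeffs-y → Nonneg (act w (e s))
    positive-if (1+a≥0 , b≥0) k = subst (+ 0 Z.≤_) wαₛ
      (nonneg-lin 1+a≥0 x-αₛ-positive b≥0 x-αₜ-positive k)
      where
      a = + 1 + proj₁ coeffs-y
      b = proj₂ coeffs-y
      wαₛ : lin a (act x (e s)) b (act x (e t)) k ≡ act w (e s) k
      wαₛ = begin
        lin a (act x (e s)) b (act x (e t)) k ≡⟨ act-lin x a (e s) b (e t) k ⟨
        act x (lin a (e s) b (e t)) k         ≡⟨ act-cong x (act-word-αₛ s t y) k ⟨
        act x (act (W y) (e s)) k             ≡⟨ ≡⇒≐ (act-++ x (W y) (e s)) k ⟨
        act (x ++ W y) (e s) k                ≡⟨ run x·y≈w (e s) k ⟩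
        act w (e s) k                         ∎
        where open ≡-Reasoning

    -- y cannot end in sₛ: otherwise w sₛ ≈ x z with z shorter than y.
    not-ending-in-s : ∀ z → W y ≈ W (z ++ false ∷ []) → length y ≡ suc (length z) → ⊥
    not-ending-in-s z y≈zs |y|≡1+|z| =
      no-shortcut z (subst (length z N.<_) (sym |y|≡1+|z|) (NP.n<1+n (length z))) (nod (x ++ W z) (≈-sym ws≈xz))
      where
      ws≈xz : (w ++ s ∷ []) ≈ (x ++ W z)
      ws≈xz = begin
        w ++ s ∷ []                          ≈⟨ ≈-++ (≈-sym x·y≈w) (≈-refl {s ∷ []}) ⟩
        (x ++ W y) ++ s ∷ []                 ≈⟨ ≈-++ (≈-++ (≈-refl {x}) y≈zs) (≈-refl {s ∷ []}) ⟩
        (x ++ W (z ++ false ∷ [])) ++ s ∷ [] ≡⟨ cong (λ u → (x ++ u) ++ s ∷ []) (word-++ s t z (false ∷ [])) ⟩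
        (x ++ W z ++ s ∷ []) ++ s ∷ []       ≡⟨ cong (_++ s ∷ []) (sym (++-assoc x (W z) (s ∷ []))) ⟩
        ((x ++ W z) ++ s ∷ []) ++ s ∷ []     ≈⟨ snoc-snoc≈ (x ++ W z) s ⟩
        x ++ W z                             ∎
        where open ≈-Reasoning

    -- y contains no square sσσ: removing it would shorten w.
    square-free : HasSquare y → ⊥
    square-free (y₁ , y₂ , b , y≡) = no-shortcut (y₁ ++ y₂) shorter (red (x ++ W (y₁ ++ y₂)) x·y₁y₂≈w)
      where
      σ = letter s t b
      x·y₁y₂≈w : (x ++ W (y₁ ++ y₂)) ≈ w
      x·y₁y₂≈w = begin
        x ++ W (y₁ ++ y₂)               ≡⟨ cong (x ++_) (word-++ s t y₁ y₂) ⟩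
        x ++ W y₁ ++ W y₂               ≈⟨ ≈-++ (≈-refl {x}) (≈-++ (≈-refl {W y₁}) (≈-++ (≈-sym (square≈[] σ)) (≈-refl {W y₂}))) ⟩
        x ++ W y₁ ++ σ ∷ σ ∷ W y₂       ≡⟨ cong (x ++_) (sym (word-++ s t y₁ (b ∷ b ∷ y₂))) ⟩
        x ++ W (y₁ ++ b ∷ b ∷ y₂)       ≡⟨ cong (λ u → x ++ W u) (sym y≡) ⟩
        x ++ W y                        ≈⟨ x·y≈w ⟩
        w                               ∎
        where open ≈-Reasoning
      shorter : length (y₁ ++ y₂) N.< length y
      shorter = subst₂ N._<_ (sym (length-++ y₁ {y₂})) (sym (trans (cong length y≡) (length-++ y₁ {b ∷ b ∷ y₂})))
                  (NP.+-monoʳ-< (length y₁) (s≤s (NP.n≤1+n (length y₂))))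

    -- An alternating y must end in sₜ and be no longer than the braid
    -- length minus one (otherwise a braid move makes it end in sₛ); then
    -- y αₛ is one of the positive roots recorded in the rank-two data.
    length-y : ∀ b k → y ≡ alt b (suc k) → length y ≡ suc k
    length-y b k y≡ = trans (cong length y≡) (length-alt b (suc k))

    alternating-positive : ∀ b k → y ≡ alt b (suc k) → Nonneg (act w (e s))
    alternating-positive b k y≡ with flips k b in last≡
    ... | false = ⊥-elim (not-ending-in-s (alt b k) y≈zs (trans (length-y b k y≡) (cong suc (sym (length-alt b k)))))
      where
      y≈zs : W y ≈ W (alt b k ++ false ∷ [])
      y≈zs = ≡⇒≈ (cong W (trans y≡ (trans (alt-snoc b k) (cong (λ l → alt b k ++ l ∷ []) last≡))))
    ... | true with k N.<? Dihedral.m D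
    ...   | yes k<m = positive-if (subst NonnegCoeffs (sym coeffs≡) (Dihedral.positive D k<m))
      where
      b≡ : b ≡ flips k true
      b≡ = trans (sym (flips-involutive k b)) (cong (flips k) last≡)
      coeffs≡ : coeffs-y ≡ coeffs (A s t) (A t s) (+ 2) (A t s) (alt (flips k true) (suc k))
      coeffs≡ = cong (coeffs (A s t) (A t s) (+ 2) (A t s)) (trans y≡ (cong (λ b → alt b (suc k)) b≡))
    ...   | no k≮m with braid-flip-last s t (Dihedral.m D) (Dihedral.braid D) b k (NP.≮⇒≥ k≮m)
    ...     | z , |z|≡k , flipped = ⊥-elim (not-ending-in-s z y≈zs (trans (length-y b k y≡) (cong suc (sym |z|≡k))))
      where
      y≈zs : W y ≈ W (z ++ false ∷ [])
      y≈zs = ≈-trans (≡⇒≈ (cong W y≡)) (subst (λ l → W (alt b (suc k)) ≈ W (z ++ not l ∷ [])) last≡ flipped)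

    w-positive : Nonneg (act w (e s))
    w-positive with shape y
    ... | empty y≡[]         = positive-if (subst NonnegCoeffs (cong (coeffs _ _ _ _) (sym y≡[])) (Z.+≤+ z≤n , Z.+≤+ z≤n))
    ... | square sq          = ⊥-elim (square-free sq)
    ... | alternating b k y≡ = alternating-positive b k y≡

  -- Positivity theorem (Humphreys §1.6): if w is reduced and ℓ(w sₛ) ≥ ℓ(w)
  -- then w αₛ ≥ 0.  Induction on a bound L for ℓ(w); for w = w' sₜ the
  -- factorisation (w' , sₜ) shows that factorisations exist, t ≠ s because
  -- w has no descent at sₛ, and a minimal factorisation is handled above.
  positivity : ∀ L → PositivityUpTo L
  positivity zero    []      _ _ s _ = nonneg-e s
  positivity (suc L) w |w|≤1+L red s nod with initLast w
  ... | []        = nonneg-e s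
  ... | w' ∷ʳ′ t  = decidable-stable (nonneg? _) λ not-positive →
    ¬¬-minimise (length ∘ proj₁) {P = Factorisation w s t} {a = w' , true ∷ []} w'-factorisation λ where
      ((x , y) , fact , minimal) → not-positive
        (MinimalFactorisation.w-positive (positivity L) (dihedral (rank2 s t s≢t)) red nod {x} {y} fact minimal
          (NP.≤-trans (minimal (w' , true ∷ []) w'-factorisation) |w'|≤L))
    where
    |w|≡ : length w ≡ suc (length w')
    |w|≡ = trans (length-++ w') (NP.+-comm (length w') 1)
    w'-factorisation : Factorisation w s t (w' , true ∷ [])
    w'-factorisation = ≈-refl , sym (trans |w|≡ (NP.+-comm 1 (length w')))
    |w'|≤L : length w' N.≤ L
    |w'|≤L = NP.≤-pred (subst (N._≤ suc L) |w|≡ |w|≤1+L)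
    s≢t : s ≢ t
    s≢t refl = NP.<-irrefl refl (subst (N._≤ length w') |w|≡ (nod w' (≈-sym (snoc-snoc≈ w' s))))

  -- Every root w αₛ is positive or negative: choose a reduced expression v
  -- of w and an expression u of v sₛ of minimal length.  If u is shorter
  -- than v then v ≈ u sₛ and w αₛ = -u αₛ ≤ 0; otherwise v has no descent at
  -- sₛ and w αₛ = v αₛ ≥ 0.
  dichotomy : ∀ w s → Nonneg (act w (e s)) ⊎ Nonpos (act w (e s))
  dichotomy w s = decidable-stable (nonneg? _ ⊎-dec nonpos? _) λ neither →
    reduced-expression w λ where
      (v , v≈w , v-reduced) → ¬¬-minimise length {P = _≈ (v ∷ʳ s)} (≈-refl {v ∷ʳ s}) λ where
        (u , u≈vs , u-minimal) → neither (compare v v≈w v-reduced u u≈vs u-minimal)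
    where
    positive : ∀ x → Reduced x → NoDescent x s → Nonneg (act x (e s))
    positive x x-reduced = positivity (length x) x NP.≤-refl x-reduced s

    compare : ∀ v → v ≈ w → Reduced v → ∀ u → u ≈ v ∷ʳ s → (∀ u' → u' ≈ v ∷ʳ s → length u N.≤ length u') →
              Nonneg (act w (e s)) ⊎ Nonpos (act w (e s))
    compare v v≈w v-reduced u u≈vs u-minimal with length u N.<? length v
    ... | yes |u|<|v| = inj₂ λ k → subst (Z._≤ + 0) (wαₛ k) (ZP.neg-mono-≤ (uαₛ≥0 k))
      where
      us≈v : (u ∷ʳ s) ≈ v
      us≈v = ≈-trans (≈-++ u≈vs (≈-refl {s ∷ []})) (snoc-snoc≈ v s)
      uαₛ≥0 : Nonneg (act u (e s))
      uαₛ≥0 = positive u (λ u' u'≈u → u-minimal u' (≈-trans u'≈u u≈vs))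
                (λ t' t'≈us → NP.<⇒≤ (NP.<-≤-trans |u|<|v| (v-reduced t' (≈-trans t'≈us us≈v))))
      wαₛ : ∀ k → - act u (e s) k ≡ act w (e s) k
      wαₛ k = begin
        - act u (e s) k         ≡⟨ act-snoc-e u s k ⟨
        act (u ∷ʳ s) (e s) k    ≡⟨ run us≈v (e s) k ⟩
        act v (e s) k           ≡⟨ run v≈w (e s) k ⟩
        act w (e s) k           ∎
        where open ≡-Reasoning
    ... | no |u|≮|v| = inj₁ λ k → subst (+ 0 Z.≤_) (run v≈w (e s) k) (positive v v-reduced no-descent k)
      where
      no-descent : NoDescent v s
      no-descent t' t'≈vs = NP.≤-trans (NP.≮⇒≥ |u|≮|v|) (u-minimal t' t'≈vs)

  root-nonzero : ∀ u i → ¬ (act u (e i) ≐ (λ _ → + 0))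
  root-nonzero u i uαᵢ≐0 with trans (sym (e-diag i)) (act-kernel u (e i) uαᵢ≐0 i)
  ... | ()

  module Longest (w₀ : Word) (longest : IsLongest w₀) where

    act-root : ∀ w β u i → (∀ k → β k ≡ act u (e i) k) → act w β ≐ act (w ++ u) (e i)
    act-root w β u i β≐uαᵢ k = trans (act-cong w β≐uαᵢ k) (≡⇒≐ (sym (act-++ w u (e i))) k)

    -- β ∉ I(w): by the dichotomy wβ is positive, so w₀ sends it to -Φ⁺.
    outside⇒inside : ∀ w β → IsPosRoot β → ¬ Inv w β → Inv (w₀ ++ w) β
    outside⇒inside w β β⁺@((u , i , β≐uαᵢ) , _) β∉I with dichotomy (w ++ u) i
    ... | inj₁ wuαᵢ≥0 = β⁺ , subst (λ v → IsPosRoot (neg v)) (sym (act-++ w₀ w β))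
                                  (proj₂ (longest (act w β) wβ⁺))
      where
      wβ⁺ : IsPosRoot (act w β)
      wβ⁺ = (w ++ u , i , act-root w β u i β≐uαᵢ) ,
            (λ k → subst (+ 0 Z.≤_) (sym (act-root w β u i β≐uαᵢ k)) (wuαᵢ≥0 k))
    ... | inj₂ wuαᵢ≤0 = ⊥-elim (β∉I (β⁺ , ((w ++ u) ∷ʳ i , i , -wβ≐) , -wβ≥0))
      where
      -wβ≐ : ∀ k → neg (act w β) k ≡ act ((w ++ u) ∷ʳ i) (e i) k
      -wβ≐ k = trans (cong -_ (act-root w β u i β≐uαᵢ k)) (sym (act-snoc-e (w ++ u) i k))
      -wβ≥0 : ∀ k → + 0 Z.≤ neg (act w β) k
      -wβ≥0 k = subst (+ 0 Z.≤_) (cong -_ (sym (act-root w β u i β≐uαᵢ k))) (ZP.neg-mono-≤ (wuαᵢ≤0 k))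

    -- β ∈ I(w): w₀ sends the positive root -wβ to -Φ⁺, so w₀wβ ≥ 0; if also
    -- β ∈ I(w₀w) then w₀wβ = 0, impossible for a root.
    inside⇒outside : ∀ w β → Inv w β → ¬ Inv (w₀ ++ w) β
    inside⇒outside w β (((u , i , β≐uαᵢ) , _) , -wβ⁺) (_ , (_ , -w₀wβ≥0)) =
      root-nonzero (w₀ ++ (w ++ u)) i λ k → begin
        act (w₀ ++ (w ++ u)) (e i) k ≡⟨ ≡⇒≐ (act-++ w₀ (w ++ u) (e i)) k ⟩
        act w₀ (act (w ++ u) (e i)) k ≡⟨ act-cong w₀ (act-root w β u i β≐uαᵢ) k ⟨
        act w₀ (act w β) k           ≡⟨ ZP.≤-antisym (w₀wβ≤0 k) (w₀wβ≥0 k) ⟩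
        + 0                          ∎
      where
      open ≡-Reasoning
      w₀wβ≥0 : ∀ k → + 0 Z.≤ act w₀ (act w β) k
      w₀wβ≥0 k = subst (+ 0 Z.≤_) (trans (cong -_ (act-neg w₀ (act w β) k)) (ZP.neg-involutive _))
                   (proj₂ (proj₂ (longest (neg (act w β)) -wβ⁺)) k)
      w₀wβ≤0 : ∀ k → act w₀ (act w β) k Z.≤ + 0
      w₀wβ≤0 k = subst (Z._≤ + 0) (ZP.neg-involutive _)
                   (ZP.neg-mono-≤ (subst (+ 0 Z.≤_) (cong -_ (≡⇒≐ (act-++ w₀ w β) k)) (-w₀wβ≥0 k)))

    separable-transfer : ∀ {w S} → Sep w S → Sep (w₀ ++ w) S
    separable-transfer (typeA₁ i) = typeA₁ i
    separable-transfer (reducible S S-reducible components) =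
      reducible S S-reducible (λ C' C'-component → separable-transfer (components C' C'-component))
    separable-transfer {w} (irreducible S i S-irreducible i∈S below upper) =
      irreducible S i S-irreducible i∈S (separable-transfer below) (swap upper)
      where
      swap : ((∀ β → Up S i β → Inv w β) ⊎ (∀ β → Up S i β → ¬ Inv w β)) →
             ((∀ β → Up S i β → Inv (w₀ ++ w) β) ⊎ (∀ β → Up S i β → ¬ Inv (w₀ ++ w) β))
      swap (inj₁ all-inside)  = inj₂ λ β β↑ → inside⇒outside w β (all-inside β β↑)
      swap (inj₂ all-outside) = inj₁ λ β β↑ → outside⇒inside w β (proj₁ (proj₁ β↑)) (all-outside β β↑)

proposition3p5 : (n : ℕ) (C : CartanMatrix n) (w w₀ : RootSystem.Word C) →
    RootSystem.IsLongest C w₀ → RootSystem.Separable C w →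
    RootSystem.Separable C (w₀ ++ w)
proposition3p5 n C w w₀ longest separable = WeylGroup.Longest.separable-transfer C w₀ longest separable
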